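{- The class of string languages generated by string $\mathrm{MILL}1$ grammars is closed under intersection.
   Context: $\mathrm{MILL}1$ is first-order multiplicative intuitionistic linear logic (formulas from atoms $p(x_1,\dots,x_n)$ — no function symbols or constants — with $\otimes,\multimap,\exists,\forall$; standard sequent calculus with multiset antecedent and single succedent). $\mathrm{FVar}(A)$: free variables; $A[h]$: substitution. Fix two distinct variables $\mathbf{s},\mathbf{t}$. A string $\mathrm{MILL}1$ grammar is $\langle T,S,\triangleright\rangle$ with $T$ a finite alphabet, $S$ a formula with $\mathrm{FVar}(S)\subseteq\{\mathbf{s},\mathbf{t}\}$, $\triangleright\subseteq T\times\mathrm{Fm}$ a finite relation with $a\triangleright A\Rightarrow\mathrm{FVar}(A)\subseteq\{\mathbf{s},\mathbf{t}\}$. It generates the string $a_1\dots a_n$ ($n\ge0$) iff there are formulas $A_i$ with $a_i\triangleright A_i$ such that $A_1[x_0/\mathbf{s},x_1/\mathbf{t}],\dots,A_n[x_{n-1}/\mathbf{s},x_n/\mathbf{t}]\vdash S[x_0/\mathbf{s},x_n/\mathbf{t}]$ is derivable in $\mathrm{MILL}1$ for distinct variables $x_0,\dots,x_n$. -}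

module Defs where

open import Data.Nat using (ℕ; zero; suc)
open import Data.Fin using (Fin; zero; suc; inject₁)
open import Data.List using (List; []; _∷_; _++_; map; concatMap; length)
open import Data.List.Relation.Unary.All using (All)
open import Data.List.Membership.Propositional using (_∈_; _∉_)
open import Data.List.Relation.Binary.Permutation.Propositional using (_↭_)
open import Data.Vec.Functional using () renaming (toList to vecToList)
open import Data.List using (lookup)
open import Data.Product using (Σ; _×_; _,_; proj₂)
open import Data.Sum using (_⊎_)
open import Relation.Binary.PropositionalEquality using (_≡_)
open import Function.Definitions using (Injective)

-- Syntax of MILL1 (locally nameless: free variables are names in ℕ,
-- bound variables are de Bruijn indices; Fm n = formulas with n binders
-- in scope; Fm 0 = ordinary formulas).

data Term (n : ℕ) : Set where
  free : ℕ → Term n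
  bvar : Fin n → Term n

infixr 7 _⊗_
infixr 6 _⊸_

data Fm (n : ℕ) : Set where
  atom : ℕ → List (Term n) → Fm n
  _⊗_  : Fm n → Fm n → Fm n
  _⊸_  : Fm n → Fm n → Fm n
  all  : Fm (suc n) → Fm n
  ex   : Fm (suc n) → Fm n

wk : ∀ {n} → Term n → Term (suc n)
wk (free x) = free x
wk (bvar i) = bvar (suc i)

lift : ∀ {m n} → (Term m → Term n) → Term (suc m) → Term (suc n)
lift f (free x)       = wk (f (free x))
lift f (bvar zero)    = bvar zero
lift f (bvar (suc i)) = wk (f (bvar i))

ren : ∀ {m n} → (Term m → Term n) → Fm m → Fm n
ren f (atom p xs) = atom p (map f xs)
ren f (A ⊗ B)     = ren f A ⊗ ren f B
ren f (A ⊸ B)     = ren f A ⊸ ren f B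
ren f (all A)     = all (ren (lift f) A)
ren f (ex A)      = ex (ren (lift f) A)

fvT : ∀ {n} → Term n → List ℕ
fvT (free x) = x ∷ []
fvT (bvar _) = []

fv : ∀ {n} → Fm n → List ℕ
fv (atom p xs) = concatMap fvT xs
fv (A ⊗ B)     = fv A ++ fv B
fv (A ⊸ B)     = fv A ++ fv B
fv (all A)     = fv A
fv (ex A)      = fv A

fvs : List (Fm 0) → List ℕ
fvs = concatMap fv

substV : ∀ {n} → (ℕ → ℕ) → Term n → Term n
substV h (free x) = free (h x)
substV h (bvar i) = bvar i

subst : ∀ {n} → (ℕ → ℕ) → Fm n → Fm n
subst h = ren (substV h)

instT : ℕ → Term 1 → Term 0
instT y (free x)    = free x
instT y (bvar zero) = free y

inst : Fm 1 → ℕ → Fm 0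
inst A y = ren (instT y) A

-- Sequent calculus for MILL1 (multiset antecedent via exchange)

infix 3 _⊢_

data _⊢_ : List (Fm 0) → Fm 0 → Set where
  ax    : ∀ {A} → A ∷ [] ⊢ A
  exch  : ∀ {Γ Δ C} → Γ ↭ Δ → Γ ⊢ C → Δ ⊢ C
  cut   : ∀ {Γ Δ A C} → Γ ⊢ A → A ∷ Δ ⊢ C → Γ ++ Δ ⊢ C
  ⊗L    : ∀ {Γ A B C} → A ∷ B ∷ Γ ⊢ C → A ⊗ B ∷ Γ ⊢ C
  ⊗R    : ∀ {Γ Δ A B} → Γ ⊢ A → Δ ⊢ B → Γ ++ Δ ⊢ A ⊗ B
  ⊸L    : ∀ {Γ Δ A B C} → Γ ⊢ A → B ∷ Δ ⊢ C → (A ⊸ B) ∷ Γ ++ Δ ⊢ C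
  ⊸R    : ∀ {Γ A B} → A ∷ Γ ⊢ B → Γ ⊢ A ⊸ B
  ∀L    : ∀ {Γ A C} y → inst A y ∷ Γ ⊢ C → all A ∷ Γ ⊢ C
  ∀R    : ∀ {Γ A} y → y ∉ fvs Γ → y ∉ fv A → Γ ⊢ inst A y → Γ ⊢ all A
  ∃L    : ∀ {Γ A C} y → y ∉ fvs Γ → y ∉ fv A → y ∉ fv C →
          inst A y ∷ Γ ⊢ C → ex A ∷ Γ ⊢ C
  ∃R    : ∀ {Γ A} y → Γ ⊢ inst A y → Γ ⊢ ex A

𝐬 𝐭 : ℕ
𝐬 = 0
𝐭 = 1

IsST : ℕ → Set
IsST x = x ≡ 𝐬 ⊎ x ≡ 𝐭

record Grammar (k : ℕ) : Set where
  field
    start    : Fm 0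
    lexicon  : List (Fin k × Fm 0)
    start-fv : All IsST (fv start)
    lex-fv   : All (λ p → All IsST (fv (proj₂ p))) lexicon

st↦ : ℕ → ℕ → ℕ → ℕ
st↦ a b zero          = a
st↦ a b (suc zero)    = b
st↦ a b (suc (suc m)) = suc (suc m)

Generates : ∀ {k} → Grammar k → List (Fin k) → Set
Generates {k} G w =
  Σ (Fin (length w) → Fm 0) λ As →
    (∀ i → (lookup w i , As i) ∈ Grammar.lexicon G) ×
    Σ (Fin (suc (length w)) → ℕ) λ x →
      Injective _≡_ _≡_ x ×
      (vecToList (λ i → subst (st↦ (x (inject₁ i)) (x (suc i))) (As i))
        ⊢ subst (st↦ (x zero) (x (Data.Fin.fromℕ (length w)))) (Grammar.start G))

-- Rename the predicate symbols of G₁ to even and those of G₂ to odd numbers and pair the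
-- lexical entries of a letter with ⊗, the start formula being S₁ ⊗ S₂.  If both grammars
-- generate w, the two derivations, after injectively renaming their variables onto one
-- common sequence, combine by ⊗R and ⊗L.  Conversely, a derivation in the intersection
-- grammar is projected onto each component through a phase model that reads the atoms of
-- one parity syntactically and erases those of the other parity to the unit: soundness for
-- this model and Okada's lemma for the syntactic part give back a derivation, without any
-- appeal to cut elimination.

module Submission where

open import Defs
open import Level using (0ℓ)
open import Data.Nat using (ℕ; zero; suc; _≟_)
open import Data.Nat.Properties using (<-irrefl; suc-injective)
open import Data.Fin using (Fin; zero; suc; inject₁; fromℕ)
import Data.Fin.Properties as Finₚ
open import Data.List
  using (List; []; _∷_; _++_; map; concatMap; filter; cartesianProduct; tabulate; length; lookup)
open import Data.List.Properties
  using (map-++; map-cong; map-∘; map-id; ++-assoc; ++-identityʳ; tabulate-cong; map-tabulate)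
open import Data.List.Extrema.Nat using (max; xs≤max)
open import Data.List.Relation.Unary.All using (All)
import Data.List.Relation.Unary.All as All
import Data.List.Relation.Unary.All.Properties as Allₚ
open import Data.List.Relation.Unary.Any using (here; there)
open import Data.List.Membership.Propositional using (_∈_; _∉_)
open import Data.List.Membership.Propositional.Properties
  using (∈-map⁺; ∈-map⁻; ∈-++⁺ˡ; ∈-++⁺ʳ; ∈-filter⁺; ∈-filter⁻; ∈-cartesianProduct⁺; ∈-cartesianProduct⁻)
open import Data.List.Relation.Binary.Permutation.Propositional using (_↭_; prep; swap; ↭-trans; ↭-sym)
import Data.List.Relation.Binary.Permutation.Propositional as ↭
open import Data.List.Relation.Binary.Permutation.Propositional.Properties
  using (map⁺; ++⁺ˡ; ++⁺ʳ; ++-comm; shift)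
open import Data.Maybe using (Maybe; just; nothing)
open import Data.Product using (Σ; ∃; ∃₂; _×_; _,_; proj₁; proj₂)
open import Data.Sum using (_⊎_; inj₁; inj₂; [_,_]′)
import Data.Sum as Sum
open import Data.Vec.Functional as Vector using (Vector)
open import Function using (id; _∘_; const)
open import Function.Definitions using (Injective)
open import Relation.Nullary using (Dec; yes; no; contradiction)
open import Relation.Unary using (Pred; _⊆_; _≐_; ⋂; ⋃)
open import Relation.Unary.Properties using (≐-refl; ≐-sym; ≐-trans)
open import Relation.Binary.PropositionalEquality
  using (_≡_; _≢_; refl; sym; trans; cong; cong₂; module ≡-Reasoning)
  renaming (subst to transport; subst₂ to transport₂)

-- Renaming, substitution and relabelling

Ren : ℕ → ℕ → Set
Ren m n = Term m → Term n

lift-cong : ∀ {m n} {f g : Ren m n} → (∀ t → f t ≡ g t) → ∀ t → lift f t ≡ lift g t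
lift-cong f≗g (free x)       = cong wk (f≗g (free x))
lift-cong f≗g (bvar zero)    = refl
lift-cong f≗g (bvar (suc i)) = cong wk (f≗g (bvar i))

ren-cong : ∀ {m n} {f g : Ren m n} → (∀ t → f t ≡ g t) → ∀ A → ren f A ≡ ren g A
ren-cong f≗g (atom p xs) = cong (atom p) (map-cong f≗g xs)
ren-cong f≗g (A ⊗ B)     = cong₂ _⊗_ (ren-cong f≗g A) (ren-cong f≗g B)
ren-cong f≗g (A ⊸ B)     = cong₂ _⊸_ (ren-cong f≗g A) (ren-cong f≗g B)
ren-cong f≗g (all A)     = cong all (ren-cong (lift-cong f≗g) A)
ren-cong f≗g (ex A)      = cong ex (ren-cong (lift-cong f≗g) A)

lift-id : ∀ {n} {f : Ren n n} → (∀ t → f t ≡ t) → ∀ t → lift f t ≡ t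
lift-id f≗id (free x)       = cong wk (f≗id (free x))
lift-id f≗id (bvar zero)    = refl
lift-id f≗id (bvar (suc i)) = cong wk (f≗id (bvar i))

ren-id : ∀ {n} {f : Ren n n} → (∀ t → f t ≡ t) → ∀ A → ren f A ≡ A
ren-id f≗id (atom p xs) = cong (atom p) (trans (map-cong f≗id xs) (map-id xs))
ren-id f≗id (A ⊗ B)     = cong₂ _⊗_ (ren-id f≗id A) (ren-id f≗id B)
ren-id f≗id (A ⊸ B)     = cong₂ _⊸_ (ren-id f≗id A) (ren-id f≗id B)
ren-id f≗id (all A)     = cong all (ren-id (lift-id f≗id) A)
ren-id f≗id (ex A)      = cong ex (ren-id (lift-id f≗id) A)

lift-wk : ∀ {m n} (f : Ren m n) t → lift f (wk t) ≡ wk (f t)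
lift-wk f (free x) = refl
lift-wk f (bvar i) = refl

lift-∘ : ∀ {l m n} (f : Ren m n) (g : Ren l m) t → lift f (lift g t) ≡ lift (λ u → f (g u)) t
lift-∘ f g (free x)       = lift-wk f (g (free x))
lift-∘ f g (bvar zero)    = refl
lift-∘ f g (bvar (suc i)) = lift-wk f (g (bvar i))

ren-∘ : ∀ {l m n} (f : Ren m n) (g : Ren l m) A → ren f (ren g A) ≡ ren (λ u → f (g u)) A
ren-∘ f g (atom p xs) = cong (atom p) (sym (map-∘ xs))
ren-∘ f g (A ⊗ B)     = cong₂ _⊗_ (ren-∘ f g A) (ren-∘ f g B)
ren-∘ f g (A ⊸ B)     = cong₂ _⊸_ (ren-∘ f g A) (ren-∘ f g B)
ren-∘ f g (all A)     = cong all (trans (ren-∘ (lift f) (lift g) A) (ren-cong (lift-∘ f g) A))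
ren-∘ f g (ex A)      = cong ex (trans (ren-∘ (lift f) (lift g) A) (ren-cong (lift-∘ f g) A))

lift-substV : ∀ {n} h (t : Term (suc n)) → lift (substV h) t ≡ substV h t
lift-substV h (free x)       = refl
lift-substV h (bvar zero)    = refl
lift-substV h (bvar (suc i)) = refl

subst-all : ∀ {n} h (A : Fm (suc n)) → subst h (all A) ≡ all (subst h A)
subst-all h A = cong all (ren-cong (lift-substV h) A)

subst-ex : ∀ {n} h (A : Fm (suc n)) → subst h (ex A) ≡ ex (subst h A)
subst-ex h A = cong ex (ren-cong (lift-substV h) A)

subst-∘ : ∀ {n} h g (A : Fm n) → subst h (subst g A) ≡ subst (λ x → h (g x)) A
subst-∘ h g A = trans (ren-∘ (substV h) (substV g) A) (ren-cong (λ { (free x) → refl ; (bvar i) → refl }) A)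

subst-inst : ∀ h (A : Fm 1) y → subst h (inst A y) ≡ inst (subst h A) (h y)
subst-inst h A y = begin
  ren (substV h) (ren (instT y) A)            ≡⟨ ren-∘ (substV h) (instT y) A ⟩
  ren (λ u → substV h (instT y u)) A          ≡⟨ ren-cong (λ { (free x) → refl ; (bvar zero) → refl }) A ⟩
  ren (λ u → instT (h y) (substV h u)) A      ≡⟨ ren-∘ (instT (h y)) (substV h) A ⟨
  ren (instT (h y)) (ren (substV h) A)        ∎
  where open ≡-Reasoning

fv-substTs : ∀ {n} h (xs : List (Term n)) → concatMap fvT (map (substV h) xs) ≡ map h (concatMap fvT xs)
fv-substTs h []            = refl
fv-substTs h (free x ∷ xs) = cong (h x ∷_) (fv-substTs h xs)
fv-substTs h (bvar i ∷ xs) = fv-substTs h xs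

fv-subst : ∀ {n} h (A : Fm n) → fv (subst h A) ≡ map h (fv A)
fv-subst h (atom p xs) = fv-substTs h xs
fv-subst h (A ⊗ B)     = trans (cong₂ _++_ (fv-subst h A) (fv-subst h B)) (sym (map-++ h (fv A) (fv B)))
fv-subst h (A ⊸ B)     = trans (cong₂ _++_ (fv-subst h A) (fv-subst h B)) (sym (map-++ h (fv A) (fv B)))
fv-subst h (all A)     = trans (cong fv (subst-all h A)) (fv-subst h A)
fv-subst h (ex A)      = trans (cong fv (subst-ex h A)) (fv-subst h A)

fvs-subst : ∀ h Γ → fvs (map (subst h) Γ) ≡ map h (fvs Γ)
fvs-subst h []      = refl
fvs-subst h (A ∷ Γ) = trans (cong₂ _++_ (fv-subst h A) (fvs-subst h Γ)) (sym (map-++ h (fv A) (fvs Γ)))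

substTs-cong : ∀ {n} {f g : ℕ → ℕ} (xs : List (Term n)) → (∀ {x} → x ∈ concatMap fvT xs → f x ≡ g x) →
  map (substV f) xs ≡ map (substV g) xs
substTs-cong []            f≗g = refl
substTs-cong (free x ∷ xs) f≗g =
  cong₂ _∷_ (cong free (f≗g (here refl))) (substTs-cong xs (λ x∈ → f≗g (there x∈)))
substTs-cong (bvar i ∷ xs) f≗g = cong (bvar i ∷_) (substTs-cong xs f≗g)

subst-cong-fv : ∀ {n} {f g : ℕ → ℕ} (A : Fm n) → (∀ {x} → x ∈ fv A → f x ≡ g x) → subst f A ≡ subst g A
subst-cong-fv (atom p xs) f≗g = cong (atom p) (substTs-cong xs f≗g)
subst-cong-fv (A ⊗ B) f≗g =
  cong₂ _⊗_ (subst-cong-fv A (λ x∈ → f≗g (∈-++⁺ˡ x∈))) (subst-cong-fv B (λ x∈ → f≗g (∈-++⁺ʳ (fv A) x∈)))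
subst-cong-fv (A ⊸ B) f≗g =
  cong₂ _⊸_ (subst-cong-fv A (λ x∈ → f≗g (∈-++⁺ˡ x∈))) (subst-cong-fv B (λ x∈ → f≗g (∈-++⁺ʳ (fv A) x∈)))
subst-cong-fv {f = f} {g} (all A) f≗g =
  trans (subst-all f A) (trans (cong all (subst-cong-fv A f≗g)) (sym (subst-all g A)))
subst-cong-fv {f = f} {g} (ex A) f≗g =
  trans (subst-ex f A) (trans (cong ex (subst-cong-fv A f≗g)) (sym (subst-ex g A)))

closeT : ∀ {n} → Vector ℕ n → Term n → Term 0
closeT σ (free x) = free x
closeT σ (bvar i) = free (σ i)

close : ∀ {n} → Vector ℕ n → Fm n → Fm 0
close σ = ren (closeT σ)

close-[] : ∀ A → close Vector.[] A ≡ A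
close-[] = ren-id λ { (free x) → refl }

inst-close : ∀ {n} (A : Fm (suc n)) (σ : Vector ℕ n) y →
  inst (ren (lift (closeT σ)) A) y ≡ close (y Vector.∷ σ) A
inst-close A σ y = trans (ren-∘ (instT y) (lift (closeT σ)) A)
  (ren-cong (λ { (free x) → refl ; (bvar zero) → refl ; (bvar (suc i)) → refl }) A)

fresh : List ℕ → ℕ
fresh xs = suc (max 0 xs)

fresh-∉ : ∀ xs → fresh xs ∉ xs
fresh-∉ xs fresh∈xs = <-irrefl refl (All.lookup (xs≤max 0 xs) fresh∈xs)

relabel : ∀ {n} → (ℕ → ℕ) → Fm n → Fm n
relabel e (atom p xs) = atom (e p) xs
relabel e (A ⊗ B)     = relabel e A ⊗ relabel e B
relabel e (A ⊸ B)     = relabel e A ⊸ relabel e B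
relabel e (all A)     = all (relabel e A)
relabel e (ex A)      = ex (relabel e A)

relabel-ren : ∀ {m n} e (f : Ren m n) A → relabel e (ren f A) ≡ ren f (relabel e A)
relabel-ren e f (atom p xs) = refl
relabel-ren e f (A ⊗ B)     = cong₂ _⊗_ (relabel-ren e f A) (relabel-ren e f B)
relabel-ren e f (A ⊸ B)     = cong₂ _⊸_ (relabel-ren e f A) (relabel-ren e f B)
relabel-ren e f (all A)     = cong all (relabel-ren e (lift f) A)
relabel-ren e f (ex A)      = cong ex (relabel-ren e (lift f) A)

fv-relabel : ∀ {n} e (A : Fm n) → fv (relabel e A) ≡ fv A
fv-relabel e (atom p xs) = refl
fv-relabel e (A ⊗ B)     = cong₂ _++_ (fv-relabel e A) (fv-relabel e B)
fv-relabel e (A ⊸ B)     = cong₂ _++_ (fv-relabel e A) (fv-relabel e B)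
fv-relabel e (all A)     = fv-relabel e A
fv-relabel e (ex A)      = fv-relabel e A

fvs-relabel : ∀ e Γ → fvs (map (relabel e) Γ) ≡ fvs Γ
fvs-relabel e []      = refl
fvs-relabel e (A ∷ Γ) = cong₂ _++_ (fv-relabel e A) (fvs-relabel e Γ)

relabel-⊢ : ∀ e {Γ C} → Γ ⊢ C → map (relabel e) Γ ⊢ relabel e C
relabel-⊢ e ax         = ax
relabel-⊢ e (exch p d) = exch (map⁺ (relabel e) p) (relabel-⊢ e d)
relabel-⊢ e (cut {Γ} {Δ} d₁ d₂) =
  transport (_⊢ _) (sym (map-++ (relabel e) Γ Δ)) (cut (relabel-⊢ e d₁) (relabel-⊢ e d₂))
relabel-⊢ e (⊗L d) = ⊗L (relabel-⊢ e d)
relabel-⊢ e (⊗R {Γ} {Δ} d₁ d₂) =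
  transport (_⊢ _) (sym (map-++ (relabel e) Γ Δ)) (⊗R (relabel-⊢ e d₁) (relabel-⊢ e d₂))
relabel-⊢ e (⊸L {Γ} {Δ} {A} {B} d₁ d₂) =
  transport (λ Θ → relabel e (A ⊸ B) ∷ Θ ⊢ _) (sym (map-++ (relabel e) Γ Δ))
    (⊸L (relabel-⊢ e d₁) (relabel-⊢ e d₂))
relabel-⊢ e (⊸R d) = ⊸R (relabel-⊢ e d)
relabel-⊢ e (∀L {Γ} {A} y d) =
  ∀L y (transport (λ X → X ∷ map (relabel e) Γ ⊢ _) (relabel-ren e (instT y) A) (relabel-⊢ e d))
relabel-⊢ e (∀R {Γ} {A} y y∉Γ y∉A d) =
  ∀R y (transport (y ∉_) (sym (fvs-relabel e Γ)) y∉Γ) (transport (y ∉_) (sym (fv-relabel e A)) y∉A)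
     (transport (_ ⊢_) (relabel-ren e (instT y) A) (relabel-⊢ e d))
relabel-⊢ e (∃L {Γ} {A} {C} y y∉Γ y∉A y∉C d) =
  ∃L y (transport (y ∉_) (sym (fvs-relabel e Γ)) y∉Γ) (transport (y ∉_) (sym (fv-relabel e A)) y∉A)
     (transport (y ∉_) (sym (fv-relabel e C)) y∉C)
     (transport (λ X → X ∷ map (relabel e) Γ ⊢ _) (relabel-ren e (instT y) A) (relabel-⊢ e d))
relabel-⊢ e (∃R {A = A} y d) = ∃R y (transport (_ ⊢_) (relabel-ren e (instT y) A) (relabel-⊢ e d))

∉-map⁺ : ∀ {h : ℕ → ℕ} → Injective _≡_ _≡_ h → ∀ {y xs} → y ∉ xs → h y ∉ map h xs
∉-map⁺ h-inj y∉xs hy∈ with ∈-map⁻ _ hy∈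
... | x , x∈xs , hy≡hx = y∉xs (transport (_∈ _) (sym (h-inj hy≡hx)) x∈xs)

subst-⊢ : ∀ {h} → Injective _≡_ _≡_ h → ∀ {Γ C} → Γ ⊢ C → map (subst h) Γ ⊢ subst h C
subst-⊢ h-inj ax = ax
subst-⊢ {h} h-inj (exch p d) = exch (map⁺ (subst h) p) (subst-⊢ h-inj d)
subst-⊢ {h} h-inj (cut {Γ} {Δ} d₁ d₂) =
  transport (_⊢ _) (sym (map-++ (subst h) Γ Δ)) (cut (subst-⊢ h-inj d₁) (subst-⊢ h-inj d₂))
subst-⊢ h-inj (⊗L d) = ⊗L (subst-⊢ h-inj d)
subst-⊢ {h} h-inj (⊗R {Γ} {Δ} d₁ d₂) =
  transport (_⊢ _) (sym (map-++ (subst h) Γ Δ)) (⊗R (subst-⊢ h-inj d₁) (subst-⊢ h-inj d₂))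
subst-⊢ {h} h-inj (⊸L {Γ} {Δ} {A} {B} d₁ d₂) =
  transport (λ Θ → subst h (A ⊸ B) ∷ Θ ⊢ _) (sym (map-++ (subst h) Γ Δ))
    (⊸L (subst-⊢ h-inj d₁) (subst-⊢ h-inj d₂))
subst-⊢ h-inj (⊸R d) = ⊸R (subst-⊢ h-inj d)
subst-⊢ {h} h-inj (∀L {Γ} {A} {C} y d) =
  transport (λ X → X ∷ map (subst h) Γ ⊢ subst h C) (sym (subst-all h A))
    (∀L (h y) (transport (λ X → X ∷ map (subst h) Γ ⊢ subst h C) (subst-inst h A y) (subst-⊢ h-inj d)))
subst-⊢ {h} h-inj (∀R {Γ} {A} y y∉Γ y∉A d) =
  transport (map (subst h) Γ ⊢_) (sym (subst-all h A))
    (∀R (h y) (transport (h y ∉_) (sym (fvs-subst h Γ)) (∉-map⁺ h-inj y∉Γ))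
              (transport (h y ∉_) (sym (fv-subst h A)) (∉-map⁺ h-inj y∉A))
              (transport (map (subst h) Γ ⊢_) (subst-inst h A y) (subst-⊢ h-inj d)))
subst-⊢ {h} h-inj (∃L {Γ} {A} {C} y y∉Γ y∉A y∉C d) =
  transport (λ X → X ∷ map (subst h) Γ ⊢ subst h C) (sym (subst-ex h A))
    (∃L (h y) (transport (h y ∉_) (sym (fvs-subst h Γ)) (∉-map⁺ h-inj y∉Γ))
              (transport (h y ∉_) (sym (fv-subst h A)) (∉-map⁺ h-inj y∉A))
              (transport (h y ∉_) (sym (fv-subst h C)) (∉-map⁺ h-inj y∉C))
              (transport (λ X → X ∷ map (subst h) Γ ⊢ subst h C) (subst-inst h A y) (subst-⊢ h-inj d)))
subst-⊢ {h} h-inj (∃R {Γ} {A} y d) =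
  transport (map (subst h) Γ ⊢_) (sym (subst-ex h A))
    (∃R (h y) (transport (map (subst h) Γ ⊢_) (subst-inst h A y) (subst-⊢ h-inj d)))

-- Phase semantics

Fact : Set₁
Fact = Pred (List (Fm 0)) 0ℓ

infixr 7 _·_
infixr 6 _⊸ᶠ_

_·_ : Fact → Fact → Fact
(X · Y) Γ = ∃₂ λ Γ₁ Γ₂ → Γ ≡ Γ₁ ++ Γ₂ × X Γ₁ × Y Γ₂

_⊸ᶠ_ : Fact → Fact → Fact
(X ⊸ᶠ Y) Γ = ∀ Γ' → X Γ' → Y (Γ ++ Γ')

-- The phase closure: the biorthogonal of X with respect to derivability.
Cl : Fact → Fact
Cl X Γ = ∀ Δ C → X ⊆ (λ Γ' → Γ' ++ Δ ⊢ C) → Γ ++ Δ ⊢ C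

Closed : Fact → Set
Closed X = Cl X ⊆ X

PermInvariant : Fact → Set
PermInvariant X = ∀ {Γ Γ'} → Γ ↭ Γ' → X Γ → X Γ'

One : Fact
One = Cl (_≡ [])

private
  variable
    X Y Z X' Y' : Fact
    Θ₁ Θ₂ : List (Fm 0)

Cl-unit : X ⊆ Cl X
Cl-unit x Δ C X⊢ = X⊢ x

Cl-mono : X ⊆ Y → Cl X ⊆ Cl Y
Cl-mono X⊆Y c Δ C Y⊢ = c Δ C (λ x → Y⊢ (X⊆Y x))

Cl-closed : Closed (Cl X)
Cl-closed c Δ C X⊢ = c Δ C (λ c' → c' Δ C X⊢)

Cl-least : Closed Z → X ⊆ Z → Cl X ⊆ Z
Cl-least Z-closed X⊆Z c = Z-closed (Cl-mono X⊆Z c)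

Cl-↭ : PermInvariant (Cl X)
Cl-↭ Γ↭Γ' c Δ C X⊢ = exch (++⁺ʳ Δ Γ↭Γ') (c Δ C X⊢)

Cl-elim : Closed Z → Cl X Θ₁ → (∀ {Γ} → X Γ → Z (Γ ++ Θ₂)) → Z (Θ₁ ++ Θ₂)
Cl-elim {Θ₁ = Θ₁} {Θ₂ = Θ₂} Z-closed c X⇒Z = Z-closed λ Δ C Z⊢ →
  transport (_⊢ C) (sym (++-assoc Θ₁ Θ₂ Δ))
    (c (Θ₂ ++ Δ) C λ {Γ} x → transport (_⊢ C) (++-assoc Γ Θ₂ Δ) (Z⊢ (X⇒Z x)))

[]∈One : One []
[]∈One = Cl-unit refl

One-++ : Closed Z → One Θ₁ → Z Θ₂ → Z (Θ₁ ++ Θ₂)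
One-++ Z-closed one z = Cl-elim Z-closed one λ { refl → z }

Cl-·-Oneʳ : Closed Z → PermInvariant Z → X ⊆ Z → Y ⊆ One → Cl (X · Y) ⊆ Z
Cl-·-Oneʳ Z-closed Z-↭ X⊆Z Y⊆One = Cl-least Z-closed λ { (Γ₁ , Γ₂ , refl , x , y) →
  Z-↭ (++-comm Γ₂ Γ₁) (One-++ Z-closed (Y⊆One y) (X⊆Z x)) }

Cl-·-Oneˡ : Closed Z → Y ⊆ One → X ⊆ Z → Cl (Y · X) ⊆ Z
Cl-·-Oneˡ Z-closed Y⊆One X⊆Z =
  Cl-least Z-closed λ { (Γ₁ , Γ₂ , refl , y , x) → One-++ Z-closed (Y⊆One y) (X⊆Z x) }

⊢-closed : ∀ {C} → Closed (_⊢ C)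
⊢-closed {C} {Γ} c =
  transport (_⊢ C) (++-identityʳ Γ) (c [] C λ {Γ'} ⊢C → transport (_⊢ C) (sym (++-identityʳ Γ')) ⊢C)

⊸ᶠ-closed : Closed Y → Closed (X ⊸ᶠ Y)
⊸ᶠ-closed {Y} Y-closed {Γ} c Γ' x = Y-closed λ Δ C Y⊢ →
  transport (_⊢ C) (sym (++-assoc Γ Γ' Δ))
    (c (Γ' ++ Δ) C λ {Γ''} f → transport (_⊢ C) (++-assoc Γ'' Γ' Δ) (Y⊢ (f Γ' x)))

⋂-closed : {F : ℕ → Fact} → (∀ z → Closed (F z)) → Closed (⋂ ℕ F)
⋂-closed F-closed c z = F-closed z λ Δ C F⊢ → c Δ C (λ f → F⊢ (f z))

⊸ᶠ-↭ : PermInvariant Y → PermInvariant (X ⊸ᶠ Y)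
⊸ᶠ-↭ Y-↭ Γ↭Γ' f Γ'' x = Y-↭ (++⁺ʳ Γ'' Γ↭Γ') (f Γ'' x)

⋂-↭ : {F : ℕ → Fact} → (∀ z → PermInvariant (F z)) → PermInvariant (⋂ ℕ F)
⋂-↭ F-↭ Γ↭Γ' f z = F-↭ z Γ↭Γ' (f z)

Cl-cong : X ≐ Y → Cl X ≐ Cl Y
Cl-cong (X⊆Y , Y⊆X) = Cl-mono X⊆Y , Cl-mono Y⊆X

·-cong : X ≐ X' → Y ≐ Y' → (X · Y) ≐ (X' · Y')
·-cong (X⊆X' , X'⊆X) (Y⊆Y' , Y'⊆Y) =
  (λ (Γ₁ , Γ₂ , eq , x , y) → Γ₁ , Γ₂ , eq , X⊆X' x , Y⊆Y' y) ,
  (λ (Γ₁ , Γ₂ , eq , x , y) → Γ₁ , Γ₂ , eq , X'⊆X x , Y'⊆Y y)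

⊸ᶠ-cong : X ≐ X' → Y ≐ Y' → (X ⊸ᶠ Y) ≐ (X' ⊸ᶠ Y')
⊸ᶠ-cong (X⊆X' , X'⊆X) (Y⊆Y' , Y'⊆Y) =
  (λ f Γ' x → Y⊆Y' (f Γ' (X'⊆X x))) , (λ f Γ' x → Y'⊆Y (f Γ' (X⊆X' x)))

⋂-cong : {F G : ℕ → Fact} → (∀ z → F z ≐ G z) → ⋂ ℕ F ≐ ⋂ ℕ G
⋂-cong F≐G = (λ f z → proj₁ (F≐G z) (f z)) , (λ g z → proj₂ (F≐G z) (g z))

⋃-cong : {F G : ℕ → Fact} → (∀ z → F z ≐ G z) → ⋃ ℕ F ≐ ⋃ ℕ G
⋃-cong F≐G = (λ (z , f) → z , proj₁ (F≐G z) f) , (λ (z , g) → z , proj₂ (F≐G z) g)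

eval : ∀ {n} → (ℕ → ℕ) → Vector ℕ n → Term n → ℕ
eval ρ σ (free x) = ρ x
eval ρ σ (bvar i) = σ i

eval-wk : ∀ {n} ρ (σ : Vector ℕ n) z t → eval ρ (z Vector.∷ σ) (wk t) ≡ eval ρ σ t
eval-wk ρ σ z (free x) = refl
eval-wk ρ σ z (bvar i) = refl

eval-lift : ∀ {m n} (f : Ren m n) ρ σ σ' → (∀ t → eval ρ σ' (f t) ≡ eval ρ σ t) →
  ∀ z t → eval ρ (z Vector.∷ σ') (lift f t) ≡ eval ρ (z Vector.∷ σ) t
eval-lift f ρ σ σ' f-ok z (free x)       = trans (eval-wk ρ σ' z (f (free x))) (f-ok (free x))
eval-lift f ρ σ σ' f-ok z (bvar zero)    = refl
eval-lift f ρ σ σ' f-ok z (bvar (suc i)) = trans (eval-wk ρ σ' z (f (bvar i))) (f-ok (bvar i))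

update : (ℕ → ℕ) → ℕ → ℕ → ℕ → ℕ
update ρ y z x with x ≟ y
... | yes _ = z
... | no  _ = ρ x

update-≡ : ∀ ρ y z → update ρ y z y ≡ z
update-≡ ρ y z with y ≟ y
... | yes _  = refl
... | no y≢y = contradiction refl y≢y

update-∉ : ∀ ρ {y} z {xs} → y ∉ xs → ∀ {x} → x ∈ xs → ρ x ≡ update ρ y z x
update-∉ ρ {y} z y∉xs {x} x∈xs with x ≟ y
... | yes refl = contradiction x∈xs y∉xs
... | no  _    = refl

≡⇒≐ : ∀ {X Y : Fact} → X ≡ Y → X ≐ Y
≡⇒≐ refl = ≐-refl

module Semantics (decode : ℕ → Maybe ℕ) where

  atomFact : Maybe ℕ → List ℕ → Fact
  atomFact (just q) vs = _⊢ atom q (map free vs)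
  atomFact nothing  vs = One

  ⟦_⟧ : ∀ {n} → Fm n → (ℕ → ℕ) → Vector ℕ n → Fact
  ⟦ atom p xs ⟧ ρ σ = atomFact (decode p) (map (eval ρ σ) xs)
  ⟦ A ⊗ B ⟧     ρ σ = Cl (⟦ A ⟧ ρ σ · ⟦ B ⟧ ρ σ)
  ⟦ A ⊸ B ⟧     ρ σ = ⟦ A ⟧ ρ σ ⊸ᶠ ⟦ B ⟧ ρ σ
  ⟦ all A ⟧     ρ σ = ⋂ ℕ λ z → ⟦ A ⟧ ρ (z Vector.∷ σ)
  ⟦ ex A ⟧      ρ σ = Cl (⋃ ℕ λ z → ⟦ A ⟧ ρ (z Vector.∷ σ))

  atomFact-closed : ∀ m vs → Closed (atomFact m vs)
  atomFact-closed (just q) vs = ⊢-closed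
  atomFact-closed nothing  vs = Cl-closed

  ⟦⟧-closed : ∀ {n} (A : Fm n) ρ σ → Closed (⟦ A ⟧ ρ σ)
  ⟦⟧-closed (atom p xs) ρ σ = atomFact-closed (decode p) _
  ⟦⟧-closed (A ⊗ B)     ρ σ = Cl-closed
  ⟦⟧-closed (A ⊸ B)     ρ σ = ⊸ᶠ-closed (⟦⟧-closed B ρ σ)
  ⟦⟧-closed (all A)     ρ σ = ⋂-closed λ z → ⟦⟧-closed A ρ (z Vector.∷ σ)
  ⟦⟧-closed (ex A)      ρ σ = Cl-closed

  atomFact-↭ : ∀ m vs → PermInvariant (atomFact m vs)
  atomFact-↭ (just q) vs = exch
  atomFact-↭ nothing  vs = Cl-↭

  ⟦⟧-↭ : ∀ {n} (A : Fm n) ρ σ → PermInvariant (⟦ A ⟧ ρ σ)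
  ⟦⟧-↭ (atom p xs) ρ σ = atomFact-↭ (decode p) _
  ⟦⟧-↭ (A ⊗ B)     ρ σ = Cl-↭
  ⟦⟧-↭ (A ⊸ B)     ρ σ = ⊸ᶠ-↭ (⟦⟧-↭ B ρ σ)
  ⟦⟧-↭ (all A)     ρ σ = ⋂-↭ λ z → ⟦⟧-↭ A ρ (z Vector.∷ σ)
  ⟦⟧-↭ (ex A)      ρ σ = Cl-↭

  ⟦⟧-ren : ∀ {m n} (f : Ren m n) (A : Fm m) ρ σ σ' → (∀ t → eval ρ σ' (f t) ≡ eval ρ σ t) →
    ⟦ ren f A ⟧ ρ σ' ≐ ⟦ A ⟧ ρ σ
  ⟦⟧-ren f (atom p xs) ρ σ σ' f-ok =
    ≡⇒≐ (cong (atomFact (decode p)) (trans (sym (map-∘ xs)) (map-cong f-ok xs)))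
  ⟦⟧-ren f (A ⊗ B) ρ σ σ' f-ok = Cl-cong (·-cong (⟦⟧-ren f A ρ σ σ' f-ok) (⟦⟧-ren f B ρ σ σ' f-ok))
  ⟦⟧-ren f (A ⊸ B) ρ σ σ' f-ok = ⊸ᶠ-cong (⟦⟧-ren f A ρ σ σ' f-ok) (⟦⟧-ren f B ρ σ σ' f-ok)
  ⟦⟧-ren f (all A) ρ σ σ' f-ok = ⋂-cong λ z → ⟦⟧-ren (lift f) A ρ _ _ (eval-lift f ρ σ σ' f-ok z)
  ⟦⟧-ren f (ex A) ρ σ σ' f-ok = Cl-cong (⋃-cong λ z → ⟦⟧-ren (lift f) A ρ _ _ (eval-lift f ρ σ σ' f-ok z))

  evals-cong-fv : ∀ {n} ρ ρ' (σ : Vector ℕ n) xs → (∀ {x} → x ∈ concatMap fvT xs → ρ x ≡ ρ' x) →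
    map (eval ρ σ) xs ≡ map (eval ρ' σ) xs
  evals-cong-fv ρ ρ' σ []            ρ≗ρ' = refl
  evals-cong-fv ρ ρ' σ (free x ∷ xs) ρ≗ρ' =
    cong₂ _∷_ (ρ≗ρ' (here refl)) (evals-cong-fv ρ ρ' σ xs (λ x∈ → ρ≗ρ' (there x∈)))
  evals-cong-fv ρ ρ' σ (bvar i ∷ xs) ρ≗ρ' = cong (σ i ∷_) (evals-cong-fv ρ ρ' σ xs ρ≗ρ')

  ⟦⟧-cong-fv : ∀ {n} (A : Fm n) ρ ρ' σ → (∀ {x} → x ∈ fv A → ρ x ≡ ρ' x) → ⟦ A ⟧ ρ σ ≐ ⟦ A ⟧ ρ' σ
  ⟦⟧-cong-fv (atom p xs) ρ ρ' σ ρ≗ρ' = ≡⇒≐ (cong (atomFact (decode p)) (evals-cong-fv ρ ρ' σ xs ρ≗ρ'))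
  ⟦⟧-cong-fv (A ⊗ B) ρ ρ' σ ρ≗ρ' =
    Cl-cong (·-cong (⟦⟧-cong-fv A ρ ρ' σ (λ x∈ → ρ≗ρ' (∈-++⁺ˡ x∈)))
                    (⟦⟧-cong-fv B ρ ρ' σ (λ x∈ → ρ≗ρ' (∈-++⁺ʳ (fv A) x∈))))
  ⟦⟧-cong-fv (A ⊸ B) ρ ρ' σ ρ≗ρ' =
    ⊸ᶠ-cong (⟦⟧-cong-fv A ρ ρ' σ (λ x∈ → ρ≗ρ' (∈-++⁺ˡ x∈)))
            (⟦⟧-cong-fv B ρ ρ' σ (λ x∈ → ρ≗ρ' (∈-++⁺ʳ (fv A) x∈)))
  ⟦⟧-cong-fv (all A) ρ ρ' σ ρ≗ρ' = ⋂-cong λ z → ⟦⟧-cong-fv A ρ ρ' (z Vector.∷ σ) ρ≗ρ'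
  ⟦⟧-cong-fv (ex A)  ρ ρ' σ ρ≗ρ' = Cl-cong (⋃-cong λ z → ⟦⟧-cong-fv A ρ ρ' (z Vector.∷ σ) ρ≗ρ')

  ⟦inst⟧ : ∀ (A : Fm 1) ρ {y z} → ρ y ≡ z → ⟦ inst A y ⟧ ρ Vector.[] ≐ ⟦ A ⟧ ρ (z Vector.∷ Vector.[])
  ⟦inst⟧ A ρ ρy≡z = ⟦⟧-ren (instT _) A ρ _ Vector.[] λ { (free x) → refl ; (bvar zero) → ρy≡z }

  ⟦_⟧* : List (Fm 0) → (ℕ → ℕ) → Fact
  ⟦ []    ⟧* ρ = _≡ []
  ⟦ A ∷ Γ ⟧* ρ = ⟦ A ⟧ ρ Vector.[] · ⟦ Γ ⟧* ρ

  ⟦⟧*-++⁻ : ∀ ρ Γ Δ → ⟦ Γ ++ Δ ⟧* ρ ⊆ ⟦ Γ ⟧* ρ · ⟦ Δ ⟧* ρ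
  ⟦⟧*-++⁻ ρ []      Δ θ = [] , _ , refl , refl , θ
  ⟦⟧*-++⁻ ρ (A ∷ Γ) Δ (Θa , Θ' , refl , a , θ) with ⟦⟧*-++⁻ ρ Γ Δ θ
  ... | Θ₁ , Θ₂ , refl , θ₁ , θ₂ = Θa ++ Θ₁ , Θ₂ , sym (++-assoc Θa Θ₁ Θ₂) , (Θa , Θ₁ , refl , a , θ₁) , θ₂

  ⟦⟧*-↭ : ∀ ρ {Γ Δ} → Γ ↭ Δ → ∀ {Θ} → ⟦ Δ ⟧* ρ Θ → ∃ λ Θ' → Θ' ↭ Θ × ⟦ Γ ⟧* ρ Θ'
  ⟦⟧*-↭ ρ ↭.refl θ = _ , ↭.refl , θ
  ⟦⟧*-↭ ρ (prep A Γ↭Δ) (Θ₁ , Θ₂ , refl , a , θ) with ⟦⟧*-↭ ρ Γ↭Δ θ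
  ... | Θ₂' , Θ₂'↭Θ₂ , θ' = Θ₁ ++ Θ₂' , ++⁺ˡ Θ₁ Θ₂'↭Θ₂ , (Θ₁ , Θ₂' , refl , a , θ')
  ⟦⟧*-↭ ρ (swap A B Γ↭Δ) (Θb , _ , refl , b , (Θa , Θ₂ , refl , a , θ)) with ⟦⟧*-↭ ρ Γ↭Δ θ
  ... | Θ₂' , Θ₂'↭Θ₂ , θ' =
    Θa ++ Θb ++ Θ₂' , ↭-trans (swap-front Θa Θb Θ₂') (++⁺ˡ Θb (++⁺ˡ Θa Θ₂'↭Θ₂)) ,
    (Θa , Θb ++ Θ₂' , refl , a , (Θb , Θ₂' , refl , b , θ'))
    where
      swap-front : ∀ (xs ys zs : List (Fm 0)) → xs ++ ys ++ zs ↭ ys ++ xs ++ zs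
      swap-front xs ys zs = transport₂ _↭_ (++-assoc xs ys zs) (++-assoc ys xs zs) (++⁺ʳ zs (++-comm xs ys))
  ⟦⟧*-↭ ρ (↭.trans Γ↭Δ Δ↭Ε) θ with ⟦⟧*-↭ ρ Δ↭Ε θ
  ... | Θ' , Θ'↭Θ , θ' with ⟦⟧*-↭ ρ Γ↭Δ θ'
  ... | Θ'' , Θ''↭Θ' , θ'' = Θ'' , ↭-trans Θ''↭Θ' Θ'↭Θ , θ''

  ⟦⟧*-cong-fv : ∀ ρ ρ' Γ → (∀ {x} → x ∈ fvs Γ → ρ x ≡ ρ' x) → ⟦ Γ ⟧* ρ ⊆ ⟦ Γ ⟧* ρ'
  ⟦⟧*-cong-fv ρ ρ' []      ρ≗ρ' θ = θ
  ⟦⟧*-cong-fv ρ ρ' (A ∷ Γ) ρ≗ρ' (Θ₁ , Θ₂ , eq , a , θ) =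
    Θ₁ , Θ₂ , eq , proj₁ (⟦⟧-cong-fv A ρ ρ' Vector.[] (λ x∈ → ρ≗ρ' (∈-++⁺ˡ x∈))) a ,
    ⟦⟧*-cong-fv ρ ρ' Γ (λ x∈ → ρ≗ρ' (∈-++⁺ʳ (fv A) x∈)) θ

  ⟦inst⟧-update : ∀ (A : Fm 1) ρ {y} z → y ∉ fv A →
    ⟦ inst A y ⟧ (update ρ y z) Vector.[] ≐ ⟦ A ⟧ ρ (z Vector.∷ Vector.[])
  ⟦inst⟧-update A ρ {y} z y∉A =
    ≐-trans (⟦inst⟧ A (update ρ y z) (update-≡ ρ y z)) (≐-sym (⟦⟧-cong-fv A ρ _ _ (update-∉ ρ z y∉A)))

  soundness : ∀ {Γ C} → Γ ⊢ C → ∀ ρ → ⟦ Γ ⟧* ρ ⊆ ⟦ C ⟧ ρ Vector.[]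
  soundness (ax {A}) ρ (Θ , _ , refl , a , refl) = transport (⟦ A ⟧ ρ _) (sym (++-identityʳ Θ)) a
  soundness (exch {C = C} Γ↭Δ d) ρ θ with ⟦⟧*-↭ ρ Γ↭Δ θ
  ... | _ , Θ'↭Θ , θ' = ⟦⟧-↭ C ρ _ Θ'↭Θ (soundness d ρ θ')
  soundness (cut {Γ} {Δ} d₁ d₂) ρ θ with ⟦⟧*-++⁻ ρ Γ Δ θ
  ... | Θ₁ , Θ₂ , refl , θ₁ , θ₂ = soundness d₂ ρ (Θ₁ , Θ₂ , refl , soundness d₁ ρ θ₁ , θ₂)
  soundness (⊗L {C = C} d) ρ (Θ₁ , Θ₂ , refl , ab , θ) =
    Cl-elim (⟦⟧-closed C ρ _) ab λ { (Γa , Γb , refl , a , b) →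
      transport (⟦ C ⟧ ρ _) (sym (++-assoc Γa Γb Θ₂))
        (soundness d ρ (Γa , Γb ++ Θ₂ , refl , a , (Γb , Θ₂ , refl , b , θ))) }
  soundness (⊗R {Γ} {Δ} d₁ d₂) ρ θ with ⟦⟧*-++⁻ ρ Γ Δ θ
  ... | Θ₁ , Θ₂ , refl , θ₁ , θ₂ = Cl-unit (Θ₁ , Θ₂ , refl , soundness d₁ ρ θ₁ , soundness d₂ ρ θ₂)
  soundness (⊸L {Γ} {Δ} {C = C} d₁ d₂) ρ (Θ₀ , _ , refl , f , θ) with ⟦⟧*-++⁻ ρ Γ Δ θ
  ... | Θ₁ , Θ₂ , refl , θ₁ , θ₂ =
    transport (⟦ C ⟧ ρ _) (++-assoc Θ₀ Θ₁ Θ₂)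
      (soundness d₂ ρ (Θ₀ ++ Θ₁ , Θ₂ , refl , f Θ₁ (soundness d₁ ρ θ₁) , θ₂))
  soundness (⊸R {B = B} d) ρ {Θ} θ Γ' a =
    ⟦⟧-↭ B ρ _ (++-comm Γ' Θ) (soundness d ρ (Γ' , Θ , refl , a , θ))
  soundness (∀L {A = A} y d) ρ (Θ₁ , Θ₂ , refl , f , θ) =
    soundness d ρ (Θ₁ , Θ₂ , refl , proj₂ (⟦inst⟧ A ρ refl) (f (ρ y)) , θ)
  soundness (∀R {Γ} {A} y y∉Γ y∉A d) ρ θ z =
    proj₁ (⟦inst⟧-update A ρ z y∉A) (soundness d _ (⟦⟧*-cong-fv ρ _ Γ (update-∉ ρ z y∉Γ) θ))
  soundness (∃L {Γ} {A} {C} y y∉Γ y∉A y∉C d) ρ (Θ₁ , Θ₂ , refl , ∃a , θ) =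
    Cl-elim (⟦⟧-closed C ρ _) ∃a λ (z , a) →
      proj₂ (⟦⟧-cong-fv C ρ _ _ (update-∉ ρ z y∉C))
        (soundness d _ (_ , Θ₂ , refl , proj₂ (⟦inst⟧-update A ρ z y∉A) a ,
                        ⟦⟧*-cong-fv ρ _ Γ (update-∉ ρ z y∉Γ) θ))
  soundness (∃R {A = A} y d) ρ θ = Cl-unit (ρ y , proj₁ (⟦inst⟧ A ρ refl) (soundness d ρ θ))

  module Visible (e : ℕ → ℕ) (decode-e : ∀ p → decode (e p) ≡ just p) where

    -- Okada's lemma for formulas all of whose atoms are visible.
    ⟦relabel⟧⊆⊢close : ∀ {n} (A : Fm n) σ → ⟦ relabel e A ⟧ id σ ⊆ (_⊢ close σ A)
    close∈⟦relabel⟧ : ∀ {n} (A : Fm n) σ → ⟦ relabel e A ⟧ id σ (close σ A ∷ [])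

    eval-close : ∀ {n} (σ : Vector ℕ n) xs → map free (map (eval id σ) xs) ≡ map (closeT σ) xs
    eval-close σ xs = trans (sym (map-∘ xs)) (map-cong (λ { (free x) → refl ; (bvar i) → refl }) xs)

    ⟦relabel⟧⊆⊢close (atom p xs) σ rewrite decode-e p = transport (λ ts → _ ⊢ atom p ts) (eval-close σ xs)
    ⟦relabel⟧⊆⊢close (A ⊗ B) σ = Cl-least ⊢-closed λ { (Γ₁ , Γ₂ , refl , a , b) →
      ⊗R (⟦relabel⟧⊆⊢close A σ a) (⟦relabel⟧⊆⊢close B σ b) }
    ⟦relabel⟧⊆⊢close (A ⊸ B) σ {Γ} f =
      ⊸R (exch (++-comm Γ _) (⟦relabel⟧⊆⊢close B σ (f _ (close∈⟦relabel⟧ A σ))))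
    ⟦relabel⟧⊆⊢close (all A) σ {Γ} f =
      ∀R y (λ y∈ → y-fresh (∈-++⁺ˡ y∈)) (λ y∈ → y-fresh (∈-++⁺ʳ (fvs Γ) y∈))
        (transport (Γ ⊢_) (sym (inst-close A σ y)) (⟦relabel⟧⊆⊢close A (y Vector.∷ σ) (f y)))
      where
        avoid : List ℕ
        avoid = fvs Γ ++ fv (ren (lift (closeT σ)) A)
        y : ℕ
        y = fresh avoid
        y-fresh : y ∉ avoid
        y-fresh = fresh-∉ avoid
    ⟦relabel⟧⊆⊢close (ex A) σ = Cl-least ⊢-closed λ { {Γ} (z , a) →
      ∃R z (transport (Γ ⊢_) (sym (inst-close A σ z)) (⟦relabel⟧⊆⊢close A (z Vector.∷ σ) a)) }

    close∈⟦relabel⟧ (atom p xs) σ rewrite decode-e p =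
      transport (λ ts → atom p (map (closeT σ) xs) ∷ [] ⊢ atom p ts) (sym (eval-close σ xs)) ax
    close∈⟦relabel⟧ (A ⊗ B) σ Δ C ⊢C =
      ⊗L (⊢C (close σ A ∷ [] , close σ B ∷ [] , refl , close∈⟦relabel⟧ A σ , close∈⟦relabel⟧ B σ))
    close∈⟦relabel⟧ (A ⊸ B) σ Γ' a = ⟦⟧-closed (relabel e B) id σ λ Δ C ⊢C →
      ⊸L (⟦relabel⟧⊆⊢close A σ a) (⊢C (close∈⟦relabel⟧ B σ))
    close∈⟦relabel⟧ (all A) σ z = ⟦⟧-closed (relabel e A) id (z Vector.∷ σ) λ Δ C ⊢C →
      ∀L z (transport (λ X → X ∷ Δ ⊢ C) (sym (inst-close A σ z)) (⊢C (close∈⟦relabel⟧ A (z Vector.∷ σ))))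
    close∈⟦relabel⟧ (ex A) σ Δ C ⊢C =
      ∃L y (λ y∈ → y-fresh (∈-++⁺ˡ y∈)) (λ y∈ → y-fresh (∈-++⁺ʳ (fvs Δ) (∈-++⁺ˡ y∈)))
           (λ y∈ → y-fresh (∈-++⁺ʳ (fvs Δ) (∈-++⁺ʳ (fv A') y∈)))
        (transport (λ X → X ∷ Δ ⊢ C) (sym (inst-close A σ y)) (⊢C (y , close∈⟦relabel⟧ A (y Vector.∷ σ))))
      where
        A' : Fm 1
        A' = ren (lift (closeT σ)) A
        avoid : List ℕ
        avoid = fvs Δ ++ fv A' ++ fv C
        y : ℕ
        y = fresh avoid
        y-fresh : y ∉ avoid
        y-fresh = fresh-∉ avoid

    ⟦relabel⟧⊆⊢ : ∀ S → ⟦ relabel e S ⟧ id Vector.[] ⊆ (_⊢ S)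
    ⟦relabel⟧⊆⊢ S s = transport (_ ⊢_) (close-[] S) (⟦relabel⟧⊆⊢close S Vector.[] s)

    ∈⟦relabel⟧ : ∀ A → ⟦ relabel e A ⟧ id Vector.[] (A ∷ [])
    ∈⟦relabel⟧ A = transport (λ X → ⟦ relabel e A ⟧ id _ (X ∷ [])) (close-[] A) (close∈⟦relabel⟧ A Vector.[])

  module Erased (o : ℕ → ℕ) (decode-o : ∀ p → decode (o p) ≡ nothing) where

    ⟦relabel⟧≐One : ∀ {n} (A : Fm n) ρ σ → ⟦ relabel o A ⟧ ρ σ ≐ One
    ⟦relabel⟧≐One (atom p xs) ρ σ rewrite decode-o p = ≐-refl
    ⟦relabel⟧≐One (A ⊗ B) ρ σ =
      Cl-least Cl-closed (λ { (Γ₁ , Γ₂ , refl , a , b) → One-++ Cl-closed (proj₁ IA a) (proj₁ IB b) }) ,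
      Cl-mono λ { refl → [] , [] , refl , proj₂ IA []∈One , proj₂ IB []∈One }
      where
        IA : ⟦ relabel o A ⟧ ρ σ ≐ One
        IA = ⟦relabel⟧≐One A ρ σ
        IB : ⟦ relabel o B ⟧ ρ σ ≐ One
        IB = ⟦relabel⟧≐One B ρ σ
    ⟦relabel⟧≐One (A ⊸ B) ρ σ =
      (λ {Γ} f → transport One (++-identityʳ Γ) (proj₁ IB (f [] (proj₂ IA []∈One)))) ,
      λ u Γ' a → proj₂ IB (One-++ Cl-closed u (proj₁ IA a))
      where
        IA : ⟦ relabel o A ⟧ ρ σ ≐ One
        IA = ⟦relabel⟧≐One A ρ σ
        IB : ⟦ relabel o B ⟧ ρ σ ≐ One
        IB = ⟦relabel⟧≐One B ρ σ
    ⟦relabel⟧≐One (all A) ρ σ =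
      (λ f → proj₁ (⟦relabel⟧≐One A ρ (0 Vector.∷ σ)) (f 0)) ,
      λ u z → proj₂ (⟦relabel⟧≐One A ρ (z Vector.∷ σ)) u
    ⟦relabel⟧≐One (ex A) ρ σ =
      Cl-least Cl-closed (λ (z , a) → proj₁ (⟦relabel⟧≐One A ρ (z Vector.∷ σ)) a) ,
      Cl-mono λ { refl → 0 , proj₂ (⟦relabel⟧≐One A ρ (0 Vector.∷ σ)) []∈One }

  ⟦⟧*-tabulate : ∀ {n} (F A : Fin n → Fm 0) → (∀ i → ⟦ F i ⟧ id Vector.[] (A i ∷ [])) →
    ⟦ tabulate F ⟧* id (tabulate A)
  ⟦⟧*-tabulate {zero}  F A A∈F = refl
  ⟦⟧*-tabulate {suc n} F A A∈F = _ , _ , refl , A∈F zero , ⟦⟧*-tabulate (F ∘ suc) (A ∘ suc) (A∈F ∘ suc)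

  erase-⊢ : ∀ {n} (F A : Fin n → Fm 0) {C S} → (∀ i → ⟦ F i ⟧ id Vector.[] (A i ∷ [])) →
    ⟦ C ⟧ id Vector.[] ⊆ (_⊢ S) → tabulate F ⊢ C → tabulate A ⊢ S
  erase-⊢ F A A∈F C⊆S d = C⊆S (soundness d id (⟦⟧*-tabulate F A A∈F))

  module Projection (e o : ℕ → ℕ)
    (decode-e : ∀ p → decode (e p) ≡ just p) (decode-o : ∀ p → decode (o p) ≡ nothing) where
    open Visible e decode-e
    open Erased o decode-o

    ⊗-eraseʳ : ∀ {n} (A B : Fin n → Fm 0) S T →
      tabulate (λ i → relabel e (A i) ⊗ relabel o (B i)) ⊢ relabel e S ⊗ relabel o T → tabulate A ⊢ S
    ⊗-eraseʳ A B S T = erase-⊢ _ A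
      (λ i → Cl-unit (_ , [] , refl , ∈⟦relabel⟧ (A i) , proj₂ (⟦relabel⟧≐One (B i) id _) []∈One))
      (Cl-·-Oneʳ ⊢-closed exch (⟦relabel⟧⊆⊢ S) (proj₁ (⟦relabel⟧≐One T id _)))

    ⊗-eraseˡ : ∀ {n} (A B : Fin n → Fm 0) S T →
      tabulate (λ i → relabel o (B i) ⊗ relabel e (A i)) ⊢ relabel o T ⊗ relabel e S → tabulate A ⊢ S
    ⊗-eraseˡ A B S T = erase-⊢ _ A
      (λ i → Cl-unit ([] , _ , refl , proj₂ (⟦relabel⟧≐One (B i) id _) []∈One , ∈⟦relabel⟧ (A i)))
      (Cl-·-Oneˡ ⊢-closed (proj₁ (⟦relabel⟧≐One T id _)) (⟦relabel⟧⊆⊢ S))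

-- The intersection grammar

double : ℕ → ℕ
double zero    = zero
double (suc n) = suc (suc (double n))

double+1 : ℕ → ℕ
double+1 n = suc (double n)

double-injective : Injective _≡_ _≡_ double
double-injective {zero}  {zero}  eq = refl
double-injective {suc m} {suc n} eq = cong suc (double-injective (suc-injective (suc-injective eq)))

double≢double+1 : ∀ m n → double m ≢ double+1 n
double≢double+1 (suc m) (suc n) eq = double≢double+1 m n (suc-injective (suc-injective eq))

splitParity : ℕ → ℕ ⊎ ℕ
splitParity zero          = inj₁ zero
splitParity (suc zero)    = inj₂ zero
splitParity (suc (suc n)) = Sum.map suc suc (splitParity n)

splitParity-double : ∀ n → splitParity (double n) ≡ inj₁ n
splitParity-double zero    = refl
splitParity-double (suc n) = cong (Sum.map suc suc) (splitParity-double n)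

splitParity-double+1 : ∀ n → splitParity (double+1 n) ≡ inj₂ n
splitParity-double+1 zero    = refl
splitParity-double+1 (suc n) = cong (Sum.map suc suc) (splitParity-double+1 n)

decodeEven decodeOdd : ℕ → Maybe ℕ
decodeEven = [ just , const nothing ]′ ∘ splitParity
decodeOdd  = [ const nothing , just ]′ ∘ splitParity

infixr 7 _⊛_

_⊛_ : Fm 0 → Fm 0 → Fm 0
A ⊛ B = relabel double A ⊗ relabel double+1 B

subst-⊛ : ∀ h A B → subst h (A ⊛ B) ≡ subst h A ⊛ subst h B
subst-⊛ h A B =
  cong₂ _⊗_ (sym (relabel-ren double (substV h) A)) (sym (relabel-ren double+1 (substV h) B))

⊛-elimˡ : ∀ {n} (A B : Fin n → Fm 0) S T → tabulate (λ i → A i ⊛ B i) ⊢ S ⊛ T → tabulate A ⊢ S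
⊛-elimˡ = Semantics.Projection.⊗-eraseʳ decodeEven double double+1
  (cong [ just , const nothing ]′ ∘ splitParity-double)
  (cong [ just , const nothing ]′ ∘ splitParity-double+1)

⊛-elimʳ : ∀ {n} (A B : Fin n → Fm 0) S T → tabulate (λ i → A i ⊛ B i) ⊢ S ⊛ T → tabulate B ⊢ T
⊛-elimʳ A B S T = Semantics.Projection.⊗-eraseˡ decodeOdd double+1 double
  (cong [ const nothing , just ]′ ∘ splitParity-double+1)
  (cong [ const nothing , just ]′ ∘ splitParity-double)
  B A T S

⊗L-tabulate : ∀ {n} (F G : Fin n → Fm 0) {Δ C} →
  tabulate F ++ tabulate G ++ Δ ⊢ C → tabulate (λ i → F i ⊗ G i) ++ Δ ⊢ C
⊗L-tabulate {zero}  F G d = d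
⊗L-tabulate {suc n} F G {Δ} d =
  ⊗L (exch (front Fs⊗Gs) (⊗L-tabulate (F ∘ suc) (G ∘ suc) (exch reorder d)))
  where
    F₀ G₀ : Fm 0
    F₀ = F zero
    G₀ = G zero
    Fs Gs Fs⊗Gs : List (Fm 0)
    Fs = tabulate (F ∘ suc)
    Gs = tabulate (G ∘ suc)
    Fs⊗Gs = tabulate (λ i → F (suc i) ⊗ G (suc i))
    front : ∀ xs → xs ++ F₀ ∷ G₀ ∷ Δ ↭ F₀ ∷ G₀ ∷ xs ++ Δ
    front xs = ↭-trans (shift F₀ xs (G₀ ∷ Δ)) (prep F₀ (shift G₀ xs Δ))
    reorder : F₀ ∷ Fs ++ G₀ ∷ Gs ++ Δ ↭ Fs ++ Gs ++ F₀ ∷ G₀ ∷ Δ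
    reorder = ↭-sym (↭-trans (++⁺ˡ Fs (front Gs)) (shift F₀ Fs _))

⊗R-tabulate : ∀ {n} (F G : Fin n → Fm 0) {C D} →
  tabulate F ⊢ C → tabulate G ⊢ D → tabulate (λ i → F i ⊗ G i) ⊢ C ⊗ D
⊗R-tabulate F G dF dG = transport (_⊢ _) (++-identityʳ _)
  (⊗L-tabulate F G (transport (λ Θ → tabulate F ++ Θ ⊢ _) (sym (++-identityʳ _)) (⊗R dF dG)))

infix 8 _[_,_]

_[_,_] : Fm 0 → ℕ → ℕ → Fm 0
A [ a , b ] = subst (st↦ a b) A

link : ∀ {n} → (Fin (suc n) → ℕ) → (Fin n → Fm 0) → Fin n → Fm 0
link x As i = As i [ x (inject₁ i) , x (suc i) ]

chain : ∀ {n} → (Fin n → Fm 0) → (Fin (suc n) → ℕ) → List (Fm 0)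
chain As x = tabulate (link x As)

st↦-∘ : ∀ (h : ℕ → ℕ) a b {x} → IsST x → h (st↦ a b x) ≡ st↦ (h a) (h b) x
st↦-∘ h a b (inj₁ refl) = refl
st↦-∘ h a b (inj₂ refl) = refl

relabel-subst-[,] : ∀ e h (A : Fm 0) → All IsST (fv A) → ∀ {a b a' b'} → h a ≡ a' → h b ≡ b' →
  relabel e (subst h (A [ a , b ])) ≡ relabel e A [ a' , b' ]
relabel-subst-[,] e h A A-st {a} {b} refl refl = begin
  relabel e (subst h (subst (st↦ a b) A))
    ≡⟨ cong (relabel e) (subst-∘ h (st↦ a b) A) ⟩
  relabel e (subst (h ∘ st↦ a b) A)
    ≡⟨ cong (relabel e) (subst-cong-fv A λ x∈ → st↦-∘ h a b (All.lookup A-st x∈)) ⟩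
  relabel e (subst (st↦ (h a) (h b)) A)
    ≡⟨ relabel-ren e (substV (st↦ (h a) (h b))) A ⟩
  subst (st↦ (h a) (h b)) (relabel e A)
    ∎
  where open ≡-Reasoning

reindex-⊢ : ∀ {n} e {h} → Injective _≡_ _≡_ h → (As : Fin n → Fm 0) (S : Fm 0) →
  (∀ i → All IsST (fv (As i))) → All IsST (fv S) → ∀ {x y} → (∀ i → h (x i) ≡ y i) →
  chain As x ⊢ S [ x zero , x (fromℕ n) ] →
  chain (relabel e ∘ As) y ⊢ relabel e S [ y zero , y (fromℕ n) ]
reindex-⊢ e {h} h-inj As S As-st S-st {x} h∘x≗y d =
  transport₂ _⊢_
    (trans (map-tabulate _ (relabel e)) (tabulate-cong λ i →
      relabel-subst-[,] e h (As i) (As-st i) (h∘x≗y (inject₁ i)) (h∘x≗y (suc i))))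
    (relabel-subst-[,] e h S S-st (h∘x≗y zero) (h∘x≗y (fromℕ _)))
    (relabel-⊢ e (transport (_⊢ _) (map-tabulate _ (subst h)) (subst-⊢ h-inj d)))

module Align {m} {x y : Fin m → ℕ} (x-inj : Injective _≡_ _≡_ x) (y-inj : Injective _≡_ _≡_ y)
  where

  align : ℕ → ℕ
  align v with Finₚ.any? (λ i → y i ≟ v)
  ... | yes (i , _) = double (x i)
  ... | no  _       = double+1 v

  align-y : ∀ j → align (y j) ≡ double (x j)
  align-y j with Finₚ.any? (λ i → y i ≟ y j)
  ... | yes (i , yi≡yj) = cong (double ∘ x) (y-inj yi≡yj)
  ... | no  ∄i          = contradiction (j , refl) ∄i

  align-injective : Injective _≡_ _≡_ align
  align-injective {u} {v} eq with Finₚ.any? (λ i → y i ≟ u) | Finₚ.any? (λ i → y i ≟ v)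
  ... | yes (i , yi≡u) | yes (j , yj≡v) =
    trans (sym yi≡u) (trans (cong y (x-inj (double-injective eq))) yj≡v)
  ... | yes _          | no  _          = contradiction eq (double≢double+1 _ _)
  ... | no  _          | yes _          = contradiction (sym eq) (double≢double+1 _ _)
  ... | no  _          | no  _          = double-injective (suc-injective eq)

⊛-st : ∀ A B → All IsST (fv A) → All IsST (fv B) → All IsST (fv (A ⊛ B))
⊛-st A B A-st B-st =
  Allₚ.++⁺ (transport (All IsST) (sym (fv-relabel double A)) A-st)
          (transport (All IsST) (sym (fv-relabel double+1 B)) B-st)

module _ {k : ℕ} where

  Lexicon : Set
  Lexicon = List (Fin k × Fm 0)

  SameLetter : (Fin k × Fm 0) × (Fin k × Fm 0) → Set
  SameLetter ((a , _) , (b , _)) = a ≡ b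

  sameLetter? : ∀ entries → Dec (SameLetter entries)
  sameLetter? ((a , _) , (b , _)) = a Finₚ.≟ b

  combine : (Fin k × Fm 0) × (Fin k × Fm 0) → Fin k × Fm 0
  combine ((a , A) , (_ , B)) = a , A ⊛ B

  infixr 7 _⊛ₗ_

  _⊛ₗ_ : Lexicon → Lexicon → Lexicon
  L₁ ⊛ₗ L₂ = map combine (filter sameLetter? (cartesianProduct L₁ L₂))

  ∈-⊛ₗ⁺ : ∀ {L₁ L₂ a A B} → (a , A) ∈ L₁ → (a , B) ∈ L₂ → (a , A ⊛ B) ∈ L₁ ⊛ₗ L₂
  ∈-⊛ₗ⁺ A∈L₁ B∈L₂ = ∈-map⁺ combine (∈-filter⁺ sameLetter? (∈-cartesianProduct⁺ A∈L₁ B∈L₂) refl)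

  record ⊛ₗ-Entry (L₁ L₂ : Lexicon) (a : Fin k) (F : Fm 0) : Set where
    field
      left right : Fm 0
      F≡left⊛right : F ≡ left ⊛ right
      left∈L₁ : (a , left) ∈ L₁
      right∈L₂ : (a , right) ∈ L₂

  ∈-⊛ₗ⁻ : ∀ L₁ L₂ {a F} → (a , F) ∈ L₁ ⊛ₗ L₂ → ⊛ₗ-Entry L₁ L₂ a F
  ∈-⊛ₗ⁻ L₁ L₂ F∈L with ∈-map⁻ combine F∈L
  ... | ((a , A) , (b , B)) , p∈ , refl with ∈-filter⁻ sameLetter? {xs = cartesianProduct L₁ L₂} p∈
  ...   | p∈L₁×L₂ , refl = record
    { F≡left⊛right = refl
    ; left∈L₁ = proj₁ (∈-cartesianProduct⁻ L₁ L₂ p∈L₁×L₂)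
    ; right∈L₂ = proj₂ (∈-cartesianProduct⁻ L₁ L₂ p∈L₁×L₂)
    }

  LexiconST : Lexicon → Set
  LexiconST = All (λ entry → All IsST (fv (proj₂ entry)))

  ⊛ₗ-st : ∀ {L₁ L₂} → LexiconST L₁ → LexiconST L₂ → LexiconST (L₁ ⊛ₗ L₂)
  ⊛ₗ-st {L₁} {L₂} L₁-st L₂-st = All.tabulate λ F∈ → entry-st (∈-⊛ₗ⁻ L₁ L₂ F∈)
    where
      entry-st : ∀ {a F} → ⊛ₗ-Entry L₁ L₂ a F → All IsST (fv F)
      entry-st record { left = A ; right = B ; F≡left⊛right = refl ; left∈L₁ = A∈ ; right∈L₂ = B∈ } =
        ⊛-st A B (All.lookup L₁-st A∈) (All.lookup L₂-st B∈)

_∩ᴳ_ : ∀ {k} → Grammar k → Grammar k → Grammar k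
G₁ ∩ᴳ G₂ = record
  { start    = start G₁ ⊛ start G₂
  ; lexicon  = lexicon G₁ ⊛ₗ lexicon G₂
  ; start-fv = ⊛-st (start G₁) (start G₂) (start-fv G₁) (start-fv G₂)
  ; lex-fv   = ⊛ₗ-st (lex-fv G₁) (lex-fv G₂)
  }
  where open Grammar

module _ {n} (A B : Fin n → Fm 0) (S T : Fm 0) (x : Fin (suc n) → ℕ) where

  chain-⊛ : chain (λ i → A i ⊛ B i) x ⊢ (S ⊛ T) [ x zero , x (fromℕ n) ] →
    tabulate (λ i → link x A i ⊛ link x B i) ⊢ S [ x zero , x (fromℕ n) ] ⊛ T [ x zero , x (fromℕ n) ]
  chain-⊛ = transport₂ _⊢_ (tabulate-cong λ i → subst-⊛ _ (A i) (B i)) (subst-⊛ _ S T)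

  chain-⊛-elimˡ : chain (λ i → A i ⊛ B i) x ⊢ (S ⊛ T) [ x zero , x (fromℕ n) ] →
    chain A x ⊢ S [ x zero , x (fromℕ n) ]
  chain-⊛-elimˡ = ⊛-elimˡ (link x A) (link x B) _ _ ∘ chain-⊛

  chain-⊛-elimʳ : chain (λ i → A i ⊛ B i) x ⊢ (S ⊛ T) [ x zero , x (fromℕ n) ] →
    chain B x ⊢ T [ x zero , x (fromℕ n) ]
  chain-⊛-elimʳ = ⊛-elimʳ (link x A) (link x B) _ _ ∘ chain-⊛

module _ {k} (G₁ G₂ : Grammar k) where
  open Grammar

  ∩ᴳ-sound : ∀ w → Generates (G₁ ∩ᴳ G₂) w → Generates G₁ w × Generates G₂ w
  ∩ᴳ-sound w (As , As∈ , x , x-inj , d) =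
    (L , (λ i → left∈L₁ (entry i)) , x , x-inj , chain-⊛-elimˡ L R _ _ x d') ,
    (R , (λ i → right∈L₂ (entry i)) , x , x-inj , chain-⊛-elimʳ L R _ _ x d')
    where
      open ⊛ₗ-Entry
      entry : ∀ i → ⊛ₗ-Entry (lexicon G₁) (lexicon G₂) (lookup w i) (As i)
      entry i = ∈-⊛ₗ⁻ (lexicon G₁) (lexicon G₂) (As∈ i)
      L R : Fin (length w) → Fm 0
      L i = left (entry i)
      R i = right (entry i)
      d' : chain (λ i → L i ⊛ R i) x ⊢ (start G₁ ⊛ start G₂) [ x zero , x (fromℕ (length w)) ]
      d' = transport (_⊢ _) (tabulate-cong λ i → cong (_[ _ , _ ]) (F≡left⊛right (entry i))) d

  ∩ᴳ-complete : ∀ w → Generates G₁ w → Generates G₂ w → Generates (G₁ ∩ᴳ G₂) w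
  ∩ᴳ-complete w (A , A∈ , x , x-inj , d₁) (B , B∈ , y , y-inj , d₂) =
    (λ i → A i ⊛ B i) , (λ i → ∈-⊛ₗ⁺ (A∈ i) (B∈ i)) , double ∘ x , (λ eq → x-inj (double-injective eq)) ,
    ⊗R-tabulate _ _
      (reindex-⊢ double double-injective A (start G₁) A-st (start-fv G₁) {x} (λ _ → refl) d₁)
      (reindex-⊢ double+1 align-injective B (start G₂) B-st (start-fv G₂) align-y d₂)
    where
      open Align x-inj y-inj
      A-st : ∀ i → All IsST (fv (A i))
      A-st i = All.lookup (lex-fv G₁) (A∈ i)
      B-st : ∀ i → All IsST (fv (B i))
      B-st i = All.lookup (lex-fv G₂) (B∈ i)

theorem29 : (k : ℕ) (G₁ G₂ : Grammar k) →
    Σ (Grammar k) λ G → (w : List (Fin k)) →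
      (Generates G w → Generates G₁ w × Generates G₂ w) ×
      (Generates G₁ w × Generates G₂ w → Generates G w)
theorem29 k G₁ G₂ = G₁ ∩ᴳ G₂ , λ w → ∩ᴳ-sound G₁ G₂ w , λ (g₁ , g₂) → ∩ᴳ-complete G₁ G₂ w g₁ g₂
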